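{- For every integer $n\ge 1$, the map $f$ defined recursively below restricts to a bijection from $B_n$ onto $A_n$. (Here $A_n$ is the set of words of length $n$ over $\{1,2,3,4\}$ avoiding the factors $13$ and $24$, and $B_n$ is the set of words $w_1\cdots w_{2n+4}$ over $\{1,\dots,7\}$ with $w_1=1$, $w_{2n+4}=4$ and $|w_i-w_{i+1}|=1$ for all $1\le i\le 2n+3$.) In particular $\#A_n=\#B_n$ for all $n\ge1$.
   Context: Notation. For $k\ge1$ let $\Sigma_k=\{1,\dots,k\}$ and $\Sigma_k^n$ the set of words of length $n$ over $\Sigma_k$. A word $v$ avoids a factor $u$ if $v$ cannot be written as $v=pus$ for words $p,s$. Concatenation of words is written by juxtaposition, and e.g. $f(x)23$ denotes the word $f(x)$ followed by the letters $2,3$. Sets. $A_n\subseteq\Sigma_4^n$: words avoiding factors $13$ and $24$. $B_n\subseteq\Sigma_7^{2n+4}$: words $w_1\cdots w_{2n+4}$ with $w_1=1$, $w_{2n+4}=4$, $|w_i-w_{i+1}|=1$ for all $i$. $C_n\subseteq\Sigma_7^{2n+2}$: words $v_1\cdots v_{2n+2}$ with $v_1=1$, $|v_i-v_{i+1}|=1$ for all $i$, and $v_{2n+2}\in\{2,6\}$. $D_n$: words of $A_n$ whose last letter is $3$ or $4$. Construction of maps $f$ (on $\bigcup_n B_n$) and $g$ (on $\bigcup_n C_n$), $f(B_n)\subseteq A_n$, $g(C_n)\subseteq D_n$: Base values. $g(1212)=3$, $g(1232)=4$; $g(121212)=23$, $g(121232)=33$, $g(123212)=43$, $g(123232)=14$,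 $g(123456)=34$, $g(123432)=44$. $f(121234)=1$, $f(123454)=2$, $f(123234)=3$, $f(123434)=4$. On $B_2$, $f$ is an arbitrary bijection $B_2\to A_2$ that maps the four words of $B_2$ ending in $434$ onto the four words of $A_2$ ending in $1$, the four words of $B_2$ ending in $454$ onto the four words of $A_2$ ending in $2$, and the remaining six words of $B_2$ onto the six words of $A_2$ ending in $3$ or $4$. Recursion for $n\ge3$. Definition of $g$ on $C_n$: write a word of $C_n$ as $x\,ab$ with $x$ of length $2n$ (so $x$ ends in $2$, $4$ or $6$). - If $x$ ends in $4$ (so $x\in B_{n-2}$): $g(x32)=f(x)23$ and $g(x56)=f(x)14$. - If $x$ ends in $2$ (so $x\in C_{n-1}$): $g(x12)=g(x)3$ and $g(x32)=g(x)4$. - If $x$ ends in $6$ (so $x\in C_{n-1}$): $g(x56)=g(x)3$ and $g(x76)=g(x)4$. Definition of $f$ on $B_n$, for $w=w_1\cdots w_{2n+4}\in B_n$: - If $w_{2n+2}=4$, then $w=w'34$ or $w=w'54$ with $w'\in B_{n-1}$; set $f(w'34)=f(w')1$ and $f(w'54)=f(w')2$. - If $w_{2n+2}\ne4$ but $w_{2n}=4$, then $w=w''3234$ or $w=w''5654$ with $w''\in B_{n-2}$; set $f(w''3234)=f(w'')23$ and $f(w''5654)=f(w'')14$. - If $w_{2n+2}\ne4$ and $w_{2n}\ne4$, the prefix $x$ of $w$ of length $2n$ lies in $C_{n-1}$. If $x$ ends in $2$, set $f(x1234)=g(x)3$ and $f(x3234)=g(x)4$; if $x$ ends in $6$, set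 $f(x5654)=g(x)3$ and $f(x7654)=g(x)4$. -}

module Defs where

open import Data.Nat using (ℕ; zero; suc; _+_; _*_; _≤_; ∣_-_∣)
open import Data.List using (List; []; _∷_; _++_; length; reverse; [_])
open import Data.List.Relation.Unary.All using (All)
open import Data.List.Relation.Unary.Unique.Propositional using (Unique)
open import Data.List.Relation.Unary.Linked using (Linked)
open import Data.List.Membership.Propositional using (_∈_)
open import Data.Product using (Σ; ∃; _×_)
open import Data.Sum using (_⊎_)
open import Relation.Nullary using (¬_)
open import Relation.Binary.PropositionalEquality using (_≡_)
open import Function.Bundles using (_⇔_)

Word : Set
Word = List ℕ

OverΣ : ℕ → Word → Set
OverΣ k w = All (λ a → 1 ≤ a × a ≤ k) w

Factor : Word → Word → Set
Factor u v = ∃ λ p → ∃ λ s → v ≡ p ++ u ++ s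

Avoids : Word → Word → Set
Avoids v u = ¬ Factor u v

StartsWith : ℕ → Word → Set
StartsWith a w = ∃ λ w' → w ≡ a ∷ w'

EndsWith : Word → Word → Set
EndsWith u w = ∃ λ p → w ≡ p ++ u

Steps : Word → Set
Steps = Linked (λ a b → ∣ a - b ∣ ≡ 1)

A : ℕ → Word → Set
A n w = length w ≡ n × OverΣ 4 w × Avoids w (1 ∷ 3 ∷ []) × Avoids w (2 ∷ 4 ∷ [])

B : ℕ → Word → Set
B n w = length w ≡ 2 * n + 4 × OverΣ 7 w × StartsWith 1 w × EndsWith [ 4 ] w × Steps w

C : ℕ → Word → Set
C n w = length w ≡ 2 * n + 2 × OverΣ 7 w × StartsWith 1 w
        × (EndsWith [ 2 ] w ⊎ EndsWith [ 6 ] w) × Steps w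

-- The maps f and g, parametrised by the choice h of f on B_2.
-- fR / gR (via fT / gT) act on REVERSED words (last letter first) and return the reversed
-- image, so that "strip a suffix" becomes structural recursion.
-- Clauses are tried in order; values outside ⋃B_n / ⋃C_n are irrelevant junk.
module FG (h : Word → Word) where
  -- fT a t = (reversed) image of the reversed word a ∷ t (a = last letter).
  mutual
    fT : ℕ → Word → Word
    fT 4 (3 ∷ 2 ∷ 1 ∷ 2 ∷ 1 ∷ []) = 1 ∷ []          -- f(121234) = 1
    fT 4 (5 ∷ 4 ∷ 3 ∷ 2 ∷ 1 ∷ []) = 2 ∷ []          -- f(123454) = 2
    fT 4 (3 ∷ 2 ∷ 3 ∷ 2 ∷ 1 ∷ []) = 3 ∷ []          -- f(123234) = 3
    fT 4 (3 ∷ 4 ∷ 3 ∷ 2 ∷ 1 ∷ []) = 4 ∷ []          -- f(123434) = 4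
    -- on B_2 (words of length 8): the chosen h
    fT a t@(_ ∷ _ ∷ _ ∷ _ ∷ _ ∷ _ ∷ _ ∷ []) = reverse (h (reverse (a ∷ t)))
    fT 4 (3 ∷ 4 ∷ r) = 1 ∷ fT 4 r                   -- f(w'34) = f(w')1
    fT 4 (5 ∷ 4 ∷ r) = 2 ∷ fT 4 r                   -- f(w'54) = f(w')2
    fT 4 (3 ∷ 2 ∷ 3 ∷ 4 ∷ r) = 3 ∷ 2 ∷ fT 4 r       -- f(w''3234) = f(w'')23
    fT 4 (5 ∷ 6 ∷ 5 ∷ 4 ∷ r) = 4 ∷ 1 ∷ fT 4 r       -- f(w''5654) = f(w'')14
    fT 4 (3 ∷ 2 ∷ 1 ∷ 2 ∷ r) = 3 ∷ gT 2 r           -- f(x1234) = g(x)3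
    fT 4 (3 ∷ 2 ∷ 3 ∷ 2 ∷ r) = 4 ∷ gT 2 r           -- f(x3234) = g(x)4
    fT 4 (5 ∷ 6 ∷ 5 ∷ 6 ∷ r) = 3 ∷ gT 6 r           -- f(x5654) = g(x)3
    fT 4 (5 ∷ 6 ∷ 7 ∷ 6 ∷ r) = 4 ∷ gT 6 r           -- f(x7654) = g(x)4
    fT _ _ = []

    gT : ℕ → Word → Word
    gT 2 (1 ∷ 2 ∷ 1 ∷ []) = 3 ∷ []                  -- g(1212) = 3
    gT 2 (3 ∷ 2 ∷ 1 ∷ []) = 4 ∷ []                  -- g(1232) = 4
    gT 2 (1 ∷ 2 ∷ 1 ∷ 2 ∷ 1 ∷ []) = 3 ∷ 2 ∷ []      -- g(121212) = 23
    gT 2 (3 ∷ 2 ∷ 1 ∷ 2 ∷ 1 ∷ []) = 3 ∷ 3 ∷ []      -- g(121232) = 33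
    gT 2 (1 ∷ 2 ∷ 3 ∷ 2 ∷ 1 ∷ []) = 3 ∷ 4 ∷ []      -- g(123212) = 43
    gT 2 (3 ∷ 2 ∷ 3 ∷ 2 ∷ 1 ∷ []) = 4 ∷ 1 ∷ []      -- g(123232) = 14
    gT 6 (5 ∷ 4 ∷ 3 ∷ 2 ∷ 1 ∷ []) = 4 ∷ 3 ∷ []      -- g(123456) = 34
    gT 2 (3 ∷ 4 ∷ 3 ∷ 2 ∷ 1 ∷ []) = 4 ∷ 4 ∷ []      -- g(123432) = 44
    gT 2 (3 ∷ 4 ∷ r) = 3 ∷ 2 ∷ fT 4 r               -- g(x32) = f(x)23
    gT 6 (5 ∷ 4 ∷ r) = 4 ∷ 1 ∷ fT 4 r               -- g(x56) = f(x)14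
    gT 2 (1 ∷ 2 ∷ r) = 3 ∷ gT 2 r                   -- g(x12) = g(x)3
    gT 2 (3 ∷ 2 ∷ r) = 4 ∷ gT 2 r                   -- g(x32) = g(x)4
    gT 6 (5 ∷ 6 ∷ r) = 3 ∷ gT 6 r                   -- g(x56) = g(x)3
    gT 6 (7 ∷ 6 ∷ r) = 4 ∷ gT 6 r                   -- g(x76) = g(x)4
    gT _ _ = []

  fR : Word → Word
  fR [] = []
  fR (a ∷ t) = fT a t

  gR : Word → Word
  gR [] = []
  gR (a ∷ t) = gT a t

  f : Word → Word
  f w = reverse (fR (reverse w))

  g : Word → Word
  g w = reverse (gR (reverse w))

MapsTo : (Word → Word) → (Word → Set) → (Word → Set) → Set
MapsTo φ S T = ∀ w → S w → T (φ w)

InjOn : (Word → Word) → (Word → Set) → Set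
InjOn φ S = ∀ u v → S u → S v → φ u ≡ φ v → u ≡ v

SurjOnto : (Word → Word) → (Word → Set) → (Word → Set) → Set
SurjOnto φ S T = ∀ v → T v → ∃ λ w → S w × φ w ≡ v

BijOn : (Word → Word) → (Word → Set) → (Word → Set) → Set
BijOn φ S T = MapsTo φ S T × InjOn φ S × SurjOnto φ S T

AdmissibleB2 : (Word → Word) → Set
AdmissibleB2 h =
  BijOn h (B 2) (A 2)
  × (∀ w → B 2 w → EndsWith (4 ∷ 3 ∷ 4 ∷ []) w → EndsWith [ 1 ] (h w))
  × (∀ w → B 2 w → EndsWith (4 ∷ 5 ∷ 4 ∷ []) w → EndsWith [ 2 ] (h w))
  × (∀ w → B 2 w → ¬ EndsWith (4 ∷ 3 ∷ 4 ∷ []) w → ¬ EndsWith (4 ∷ 5 ∷ 4 ∷ []) w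
       → EndsWith [ 3 ] (h w) ⊎ EndsWith [ 4 ] (h w))

HasCard : (Word → Set) → ℕ → Set
HasCard S m = Σ (List Word) λ L → Unique L × (∀ w → (w ∈ L) ⇔ S w) × length L ≡ m

-- FG.fT / FG.gT act on words read backwards, and so does the proof.  Backwards, a word
-- of B_n is 4 ∷ t with t a walk of 2n + 3 steps on the path graph 1 – 2 – … – 7 ending
-- at 1 (RevB), a word of C_n is a ∷ t with a ∈ {2, 6} and t a walk of 2n + 1 steps
-- (RevC), a word of A_n is a good word: letters in Σ₄, no factor 31 or 42 (RevA), and
-- D_n consists of the good words starting with 3 or 4 (RevD).  For n ≥ 3 the recursion
-- matches two decompositions of the domains (FView, GView)
--   B_n = B_{n-1}34 ⊔ B_{n-1}54 ⊔ C_n(34 | 54),     f = f(w′)1, f(w′)2, g(y),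
--   C_n = B_{n-2}32 ⊔ B_{n-2}56 ⊔ C_{n-1}(a∓1)a,    g = f(x)23, f(x)14, g(x)3, g(x)4,
-- with A_n = A_{n-1}1 ⊔ A_{n-1}2 ⊔ D_n and D_n = A_{n-2}23 ⊔ A_{n-2}14 ⊔ D_{n-1}3 ⊔ D_{n-1}4
-- (AView, DView), so f : B_n → A_n and g : C_n → D_n are bijections by simultaneous
-- induction from the tables for f on B_1, g on C_2 and f = h on B_2 (module Recursion).

module Submission where

open import Defs
open import Data.Nat using (ℕ; zero; suc; pred; _+_; _*_; _≤_; _<_; _≤?_; _≟_; ∣_-_∣; s≤s)
open import Data.Nat.Properties using (suc-injective; +-comm; *-suc)
open import Data.List using (List; []; _∷_; _++_; length; reverse; [_]; map; concatMap; deduplicate; _ʳ++_)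
open import Data.List.Properties
  using (≡-dec; length-map; length-reverse; reverse-involutive; reverse-injective; reverse-++;
         unfold-reverse; ∷-injectiveˡ; ∷-injectiveʳ; ++-assoc)
open import Data.List.Relation.Unary.All as All using (All; []; _∷_)
open import Data.List.Relation.Unary.Any as Any using (here; there)
open import Data.List.Relation.Unary.AllPairs using (AllPairs; []; _∷_)
import Data.List.Relation.Unary.AllPairs.Properties as AllPairs
open import Data.List.Relation.Unary.Linked as Linked using (Linked; []; [-]; _∷_)
open import Data.List.Relation.Unary.Unique.Propositional using (Unique)
open import Data.List.Relation.Unary.Unique.DecPropositional.Properties using (deduplicate-!)
open import Data.List.Membership.Propositional using (_∈_)
open import Data.List.Membership.Propositional.Properties
  using (∈-map⁺; ∈-map⁻; ∈-concatMap⁺; ∈-deduplicate⁺; ∈-deduplicate⁻)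
open import Data.Product using (Σ; ∃; _×_; _,_; proj₁)
open import Data.Sum using (_⊎_; inj₁; inj₂)
import Data.Sum as Sum
open import Data.Empty using (⊥-elim)
open import Function using (_∘_)
open import Function.Bundles using (_⇔_; mk⇔; Equivalence)
open import Relation.Nullary using (¬_)
open import Relation.Nullary.Decidable using (True; toWitness)
open import Relation.Binary.Definitions using (DecidableEquality)
open import Relation.Binary.PropositionalEquality using (_≡_; _≢_; refl; sym; trans; cong; subst)

bijOn-cong : ∀ {φ ψ S T} → (∀ w → S w → φ w ≡ ψ w) → BijOn φ S T → BijOn ψ S T
bijOn-cong {T = T} φ≗ψ (maps , inj , surj) =
  (λ w s → subst T (φ≗ψ w s) (maps w s)) ,
  (λ u v su sv e → inj u v su sv (trans (φ≗ψ u su) (trans e (sym (φ≗ψ v sv))))) ,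
  (λ v t → let (w , s , e) = surj v t in w , s , trans (sym (φ≗ψ w s)) e)

bijOn-reverse : ∀ {φ S T S′ T′} →
  (∀ w → S′ w → S (reverse w)) → (∀ w → S w → S′ (reverse w)) →
  (∀ w → T′ w → T (reverse w)) → (∀ w → T w → T′ (reverse w)) →
  BijOn φ S T → BijOn (λ w → reverse (φ (reverse w))) S′ T′
bijOn-reverse {φ = φ} {S′ = S′} S′⇒S S⇒S′ T′⇒T T⇒T′ (maps , inj , surj) =
  (λ w s → T⇒T′ _ (maps _ (S′⇒S w s))) ,
  (λ u v su sv e → reverse-injective (inj _ _ (S′⇒S u su) (S′⇒S v sv) (reverse-injective e))) ,
  λ v t → let (w , s , e) = surj (reverse v) (T′⇒T v t) in
    reverse w , S⇒S′ w s ,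
    trans (cong (λ x → reverse (φ x)) (reverse-involutive w))
          (trans (cong reverse e) (reverse-involutive v))

injOn-retraction : ∀ {φ S} (ψ : Word → Word) → (∀ w → S w → ψ (φ w) ≡ w) → InjOn φ S
injOn-retraction ψ inv u v su sv e = trans (sym (inv u su)) (trans (cong ψ e) (inv v sv))

_≟ʷ_ : DecidableEquality Word
_≟ʷ_ = ≡-dec _≟_

hasCard-list : ∀ {S} (L : List Word) → (∀ w → w ∈ L ⇔ S w)
  → HasCard S (length (deduplicate _≟ʷ_ L))
hasCard-list L mem =
  deduplicate _≟ʷ_ L , deduplicate-! _≟ʷ_ L ,
  (λ w → mk⇔ (λ m → Equivalence.to (mem w) (∈-deduplicate⁻ _≟ʷ_ L m))
             (λ s → ∈-deduplicate⁺ _≟ʷ_ (Equivalence.from (mem w) s))) ,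
  refl

unique-map : ∀ (φ : Word → Word) {L} → (∀ {x y} → x ∈ L → y ∈ L → φ x ≡ φ y → x ≡ y)
  → Unique L → Unique (map φ L)
unique-map φ inj u = AllPairs.map⁺ (separated inj u)
  where
    separated : ∀ {L} → (∀ {x y} → x ∈ L → y ∈ L → φ x ≡ φ y → x ≡ y)
      → Unique L → AllPairs (λ x y → φ x ≢ φ y) L
    separated inj [] = []
    separated inj (x∉ ∷ u) =
      All.tabulate (λ y∈ e → All.lookup x∉ y∈ (inj (here refl) (there y∈) e)) ∷
      separated (λ x∈ y∈ → inj (there x∈) (there y∈)) u

hasCard-image : ∀ {φ S T m} → BijOn φ S T → HasCard S m → HasCard T m
hasCard-image {φ} {S} {T} (maps , inj , surj) (L , uniq , mem , len) =
  map φ L ,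
  unique-map φ (λ x∈ y∈ → inj _ _ (in-S x∈) (in-S y∈)) uniq ,
  (λ v → mk⇔ (image⇒T v) (T⇒image v)) ,
  trans (length-map φ L) len
  where
    in-S : ∀ {w} → w ∈ L → S w
    in-S {w} = Equivalence.to (mem w)
    image⇒T : ∀ v → v ∈ map φ L → T v
    image⇒T v v∈ with ∈-map⁻ φ v∈
    ... | w , w∈ , refl = maps w (in-S w∈)
    T⇒image : ∀ v → T v → v ∈ map φ L
    T⇒image v t with surj v t
    ... | w , s , refl = ∈-map⁺ φ (Equivalence.from (mem w) s)

Between : ℕ → ℕ → ℕ → Set
Between lo hi a = lo ≤ a × a ≤ hi

between : ∀ {lo hi a} {p : True (lo ≤? a)} {q : True (a ≤? hi)} → Between lo hi a
between {p = p} {q} = toWitness p , toWitness q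

data Step : ℕ → ℕ → Set where
  s12 : Step 1 2
  s21 : Step 2 1
  s23 : Step 2 3
  s32 : Step 3 2
  s34 : Step 3 4
  s43 : Step 4 3
  s45 : Step 4 5
  s54 : Step 5 4
  s56 : Step 5 6
  s65 : Step 6 5
  s67 : Step 6 7
  s76 : Step 7 6

step-sym : ∀ {a b} → Step a b → Step b a
step-sym s12 = s21
step-sym s21 = s12
step-sym s23 = s32
step-sym s32 = s23
step-sym s34 = s43
step-sym s43 = s34
step-sym s45 = s54
step-sym s54 = s45
step-sym s56 = s65
step-sym s65 = s56
step-sym s67 = s76
step-sym s76 = s67

step-source : ∀ {a b} → Step a b → Between 1 7 a
step-source s12 = between
step-source s21 = between
step-source s23 = between
step-source s32 = between
step-source s34 = between
step-source s43 = between
step-source s45 = between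
step-source s54 = between
step-source s56 = between
step-source s65 = between
step-source s67 = between
step-source s76 = between

step-distance : ∀ {a b} → Step a b → ∣ a - b ∣ ≡ 1
step-distance s12 = refl
step-distance s21 = refl
step-distance s23 = refl
step-distance s32 = refl
step-distance s34 = refl
step-distance s43 = refl
step-distance s45 = refl
step-distance s54 = refl
step-distance s56 = refl
step-distance s65 = refl
step-distance s67 = refl
step-distance s76 = refl

distance-one : ∀ a b → ∣ a - b ∣ ≡ 1 → b ≡ suc a ⊎ a ≡ suc b
distance-one zero (suc zero) _ = inj₁ refl
distance-one (suc zero) zero _ = inj₂ refl
distance-one (suc a) (suc b) d = Sum.map (cong suc) (cong suc) (distance-one a b d)

step-up : ∀ {a} → 1 ≤ a → a < 7 → Step a (suc a)
step-up {1} _ _ = s12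
step-up {2} _ _ = s23
step-up {3} _ _ = s34
step-up {4} _ _ = s45
step-up {5} _ _ = s56
step-up {6} _ _ = s67
step-up {suc (suc (suc (suc (suc (suc (suc _))))))} _ (s≤s (s≤s (s≤s (s≤s (s≤s (s≤s (s≤s ())))))))

to-step : ∀ {a b} → Between 1 7 a → Between 1 7 b → ∣ a - b ∣ ≡ 1 → Step a b
to-step {a} {b} (1≤a , a≤7) (1≤b , b≤7) d with distance-one a b d
... | inj₁ refl = step-up 1≤a b≤7
... | inj₂ refl = step-sym (step-up 1≤b a≤7)

infixr 5 _▸_
data Walk : ℕ → ℕ → Word → Set where
  done : Walk 0 1 []
  _▸_  : ∀ {k a b t} → Step a b → Walk k b t → Walk (suc k) a (b ∷ t)

walk-length : ∀ {k a t} → Walk k a t → length t ≡ k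
walk-length done = refl
walk-length (_ ▸ w) = cong suc (walk-length w)

neighbours : (a : ℕ) → List (∃ (Step a))
neighbours 1 = (2 , s12) ∷ []
neighbours 2 = (1 , s21) ∷ (3 , s23) ∷ []
neighbours 3 = (2 , s32) ∷ (4 , s34) ∷ []
neighbours 4 = (3 , s43) ∷ (5 , s45) ∷ []
neighbours 5 = (4 , s54) ∷ (6 , s56) ∷ []
neighbours 6 = (5 , s65) ∷ (7 , s67) ∷ []
neighbours 7 = (6 , s76) ∷ []
neighbours _ = []

neighbour∈ : ∀ {a b} (s : Step a b) → (b , s) ∈ neighbours a
neighbour∈ s12 = here refl
neighbour∈ s21 = here refl
neighbour∈ s23 = there (here refl)
neighbour∈ s32 = here refl
neighbour∈ s34 = there (here refl)
neighbour∈ s43 = here refl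
neighbour∈ s45 = there (here refl)
neighbour∈ s54 = here refl
neighbour∈ s56 = there (here refl)
neighbour∈ s65 = here refl
neighbour∈ s67 = there (here refl)
neighbour∈ s76 = here refl

walks : (k a : ℕ) → List (∃ (Walk k a))
walks zero 1 = ([] , done) ∷ []
walks zero _ = []
walks (suc k) a = concatMap (λ (b , s) → map (λ (t , w) → b ∷ t , s ▸ w) (walks k b)) (neighbours a)

walk∈walks : ∀ {k a t} (w : Walk k a t) → (t , w) ∈ walks k a
walk∈walks done = here refl
walk∈walks {suc k} (_▸_ {b = b} s w) =
  ∈-concatMap⁺ _ (Any.map (λ { refl → ∈-map⁺ (λ (t , w) → b ∷ t , s ▸ w) (walk∈walks w) }) (neighbour∈ s))

by-enumeration : ∀ {k a} {P : Word → Set} → All (P ∘ proj₁) (walks k a) → ∀ {t} → Walk k a t → P t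
by-enumeration checked w = All.lookup checked (walk∈walks w)

-- double n = 2n, by a recursion that unfolds definitionally.
double : ℕ → ℕ
double zero = 0
double (suc n) = suc (suc (double n))

length-B : ∀ n → 2 * n + 4 ≡ suc (3 + double n)
length-B n = trans (+-comm (2 * n) 4) (cong (4 +_) (sym (double≡ n)))
  where
    double≡ : ∀ n → double n ≡ 2 * n
    double≡ zero = refl
    double≡ (suc n) = trans (cong (suc ∘ suc) (double≡ n)) (sym (*-suc 2 n))

data RevB (n : ℕ) : Word → Set where
  revB : ∀ {t} → Walk (3 + double n) 4 t → RevB n (4 ∷ t)

read-backwards : ∀ {k a t acc} → Walk k a t → Linked Step (a ∷ acc) → All (Between 1 7) (a ∷ acc)
  → Linked Step (t ʳ++ a ∷ acc) × All (Between 1 7) (t ʳ++ a ∷ acc) × StartsWith 1 (t ʳ++ a ∷ acc)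
read-backwards {acc = acc} done linked letters = linked , letters , acc , refl
read-backwards (s ▸ w) linked letters =
  read-backwards w (step-sym s ∷ linked) (step-source (step-sym s) ∷ letters)

revB⇒B : ∀ {n l} → RevB n l → B n (reverse l)
revB⇒B {n} (revB {t} w) =
  let (linked , letters , starts) = read-backwards w [-] (between ∷ []) in
  trans (length-reverse (4 ∷ t)) (trans (cong suc (walk-length w)) (sym (length-B n))) ,
  letters , starts , (reverse t , unfold-reverse 4 t) , Linked.map step-distance linked

walk-backwards : ∀ xs {k a t} → Walk k a t → Linked Step (a ∷ xs)
  → ∃ λ b → ∃ λ t′ → ∃ λ k′ → xs ʳ++ a ∷ t ≡ b ∷ t′ × Walk k′ b t′
walk-backwards [] w _ = _ , _ , _ , refl , w
walk-backwards (x ∷ xs) w (s ∷ linked) = walk-backwards xs (step-sym s ▸ w) linked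

linked-steps : ∀ {w} → Steps w → All (Between 1 7) w → Linked Step w
linked-steps [] _ = []
linked-steps [-] _ = [-]
linked-steps (d ∷ steps) (ra ∷ letters@(rb ∷ _)) = to-step ra rb d ∷ linked-steps steps letters

B⇒revB : ∀ {n w} → B n w → RevB n (reverse w)
B⇒revB {n} (len , letters , (w′ , refl) , (p , ends) , steps)
  with walk-backwards w′ done (linked-steps steps letters)
... | b , t , k , eq , walk = subst (RevB n) (sym eq) (as-revB b≡4 k≡ walk)
  where
    as-revB : ∀ {b k t} → b ≡ 4 → k ≡ 3 + double n → Walk k b t → RevB n (b ∷ t)
    as-revB refl refl w = revB w
    b≡4 : b ≡ 4
    b≡4 = ∷-injectiveˡ (trans (sym eq) (trans (cong reverse ends) (reverse-++ p [ 4 ])))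
    k≡ : k ≡ 3 + double n
    k≡ = trans (sym (walk-length walk)) (suc-injective
           (trans (cong length (sym eq)) (trans (length-reverse (1 ∷ w′)) (trans len (length-B n)))))

factor-cons : ∀ {u l x} → Factor u l → Factor u (x ∷ l)
factor-cons {x = x} (p , s , e) = x ∷ p , s , cong (x ∷_) e

factor-reverse : ∀ {u v} → Factor u v → Factor (reverse u) (reverse v)
factor-reverse {u} (p , s , refl) =
  reverse s , reverse p ,
  trans (reverse-++ p (u ++ s))
        (trans (cong (_++ reverse p) (reverse-++ u s)) (++-assoc (reverse s) (reverse u) (reverse p)))

factor-unreverse : ∀ {u v} → Factor u (reverse v) → Factor (reverse u) v
factor-unreverse {v = v} F = subst (Factor _) (reverse-involutive v) (factor-reverse F)

all-reverse : ∀ {P : ℕ → Set} {xs} → All P xs → All P (reverse xs)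
all-reverse pxs = go [] [] pxs
  where
    go : ∀ {P : ℕ → Set} {xs} acc → All P acc → All P xs → All P (xs ʳ++ acc)
    go acc pacc [] = pacc
    go acc pacc (px ∷ pxs) = go (_ ∷ acc) (px ∷ pacc) pxs

data Letter4 : ℕ → Set where
  l1 : Letter4 1
  l2 : Letter4 2
  l3 : Letter4 3
  l4 : Letter4 4

letter4-between : ∀ {a} → Letter4 a → Between 1 4 a
letter4-between l1 = between
letter4-between l2 = between
letter4-between l3 = between
letter4-between l4 = between

to-letter4 : ∀ {a} → Between 1 4 a → Letter4 a
to-letter4 {1} _ = l1
to-letter4 {2} _ = l2
to-letter4 {3} _ = l3
to-letter4 {4} _ = l4
to-letter4 {suc (suc (suc (suc (suc _))))} (_ , s≤s (s≤s (s≤s (s≤s ()))))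

data Is34 : ℕ → Set where
  is3 : Is34 3
  is4 : Is34 4

-- `Fits a b`: in a backwards word, a may directly precede b; i.e. the
-- factor b a of the forward word is neither 13 nor 24.
data Fits : ℕ → ℕ → Set where
  fits1  : ∀ {b} → Letter4 b → Fits 1 b
  fits2  : ∀ {b} → Letter4 b → Fits 2 b
  fits32 : Fits 3 2
  fits3D : ∀ {b} → Is34 b → Fits 3 b
  fits41 : Fits 4 1
  fits4D : ∀ {b} → Is34 b → Fits 4 b

fits-left : ∀ {a b} → Fits a b → Letter4 a
fits-left (fits1 _) = l1
fits-left (fits2 _) = l2
fits-left fits32 = l3
fits-left (fits3D _) = l3
fits-left fits41 = l4
fits-left (fits4D _) = l4

mk-fits : ∀ {a b} → Letter4 a → Letter4 b → (a , b) ≢ (3 , 1) → (a , b) ≢ (4 , 2) → Fits a b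
mk-fits l1 b _ _ = fits1 b
mk-fits l2 b _ _ = fits2 b
mk-fits l3 l1 ¬31 _ = ⊥-elim (¬31 refl)
mk-fits l3 l2 _ _ = fits32
mk-fits l3 l3 _ _ = fits3D is3
mk-fits l3 l4 _ _ = fits3D is4
mk-fits l4 l1 _ _ = fits41
mk-fits l4 l2 _ ¬42 = ⊥-elim (¬42 refl)
mk-fits l4 l3 _ _ = fits4D is3
mk-fits l4 l4 _ _ = fits4D is4

data Good : Word → Set where
  []ᵍ  : Good []
  [_]ᵍ : ∀ {a} → Letter4 a → Good (a ∷ [])
  _∷ᵍ_ : ∀ {a b l} → Fits a b → Good (b ∷ l) → Good (a ∷ b ∷ l)

good-tail : ∀ {a l} → Good (a ∷ l) → Good l
good-tail [ _ ]ᵍ = []ᵍ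
good-tail (_ ∷ᵍ g) = g

good-head : ∀ {a l} → Good (a ∷ l) → Letter4 a
good-head [ a ]ᵍ = a
good-head (f ∷ᵍ _) = fits-left f

prepend : ∀ {a l} → (∀ {b} → Letter4 b → Fits a b) → Letter4 a → Good l → Good (a ∷ l)
prepend _ a []ᵍ = [ a ]ᵍ
prepend {l = _ ∷ _} fits-a _ g = fits-a (good-head g) ∷ᵍ g

good-letters : ∀ {l} → Good l → All (Between 1 4) l
good-letters []ᵍ = []
good-letters [ a ]ᵍ = letter4-between a ∷ []
good-letters (f ∷ᵍ g) = letter4-between (fits-left f) ∷ good-letters g

good-factor : ∀ {a b l} → Factor (a ∷ b ∷ []) l → Good l → Fits a b
good-factor ([] , _ , refl) (f ∷ᵍ _) = f
good-factor (_ ∷ p , s , refl) g = good-factor (p , s , refl) (good-tail g)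

mk-good : ∀ {l} → All (Between 1 4) l → ¬ Factor (3 ∷ 1 ∷ []) l → ¬ Factor (4 ∷ 2 ∷ []) l → Good l
mk-good [] _ _ = []ᵍ
mk-good (ra ∷ []) _ _ = [ to-letter4 ra ]ᵍ
mk-good {a ∷ b ∷ l} (ra ∷ letters@(rb ∷ _)) ¬31 ¬42 =
  mk-fits (to-letter4 ra) (to-letter4 rb) (λ { refl → ¬31 ([] , l , refl) }) (λ { refl → ¬42 ([] , l , refl) })
  ∷ᵍ mk-good letters (¬31 ∘ factor-cons) (¬42 ∘ factor-cons)

RevA : ℕ → Word → Set
RevA n l = length l ≡ n × Good l

A⇒revA : ∀ {n v} → A n v → RevA n (reverse v)
A⇒revA {v = v} (len , letters , avoids13 , avoids24) =
  trans (length-reverse v) len ,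
  mk-good (all-reverse letters) (λ F → avoids13 (factor-unreverse F)) (λ F → avoids24 (factor-unreverse F))

revA⇒A : ∀ {n l} → RevA n l → A n (reverse l)
revA⇒A {l = l} (len , g) =
  trans (length-reverse l) len , all-reverse (good-letters g) ,
  (λ F → no31 (good-factor (factor-unreverse F) g)) ,
  (λ F → no42 (good-factor (factor-unreverse F) g))
  where
    no31 : ¬ Fits 3 1
    no31 (fits3D ())
    no42 : ¬ Fits 4 2
    no42 (fits4D ())

data RevD (n : ℕ) : Word → Set where
  revD : ∀ {a l} → Is34 a → RevA n (a ∷ l) → RevD n (a ∷ l)

¬D1 : ∀ {n l} → ¬ RevD n (1 ∷ l)
¬D1 (revD () _)

¬D2 : ∀ {n l} → ¬ RevD n (2 ∷ l)
¬D2 (revD () _)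

data AView (n : ℕ) : Word → Set where
  end1 : ∀ {l} → RevA n l → AView n (1 ∷ l)
  end2 : ∀ {l} → RevA n l → AView n (2 ∷ l)
  endD : ∀ {l} → RevD (suc n) l → AView n l

aview-sound : ∀ {n l} → AView n l → RevA (suc n) l
aview-sound (end1 (len , g)) = cong suc len , prepend fits1 l1 g
aview-sound (end2 (len , g)) = cong suc len , prepend fits2 l2 g
aview-sound (endD (revD _ a)) = a

aview : ∀ {n l} → RevA (suc n) l → AView n l
aview (len , [ l1 ]ᵍ) = end1 (suc-injective len , []ᵍ)
aview (len , [ l2 ]ᵍ) = end2 (suc-injective len , []ᵍ)
aview a@(_ , [ l3 ]ᵍ) = endD (revD is3 a)
aview a@(_ , [ l4 ]ᵍ) = endD (revD is4 a)
aview (len , fits1 _ ∷ᵍ g) = end1 (suc-injective len , g)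
aview (len , fits2 _ ∷ᵍ g) = end2 (suc-injective len , g)
aview a@(_ , fits32 ∷ᵍ _) = endD (revD is3 a)
aview a@(_ , fits3D _ ∷ᵍ _) = endD (revD is3 a)
aview a@(_ , fits41 ∷ᵍ _) = endD (revD is4 a)
aview a@(_ , fits4D _ ∷ᵍ _) = endD (revD is4 a)

data DView (n : ℕ) : Word → Set where
  end23 : ∀ {l} → RevA n l → DView n (3 ∷ 2 ∷ l)
  end14 : ∀ {l} → RevA n l → DView n (4 ∷ 1 ∷ l)
  end3  : ∀ {l} → RevD (suc n) l → DView n (3 ∷ l)
  end4  : ∀ {l} → RevD (suc n) l → DView n (4 ∷ l)

dview-sound : ∀ {n l} → DView n l → RevD (2 + n) l
dview-sound (end23 (len , g)) = revD is3 (cong (suc ∘ suc) len , fits32 ∷ᵍ prepend fits2 l2 g)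
dview-sound (end14 (len , g)) = revD is4 (cong (suc ∘ suc) len , fits41 ∷ᵍ prepend fits1 l1 g)
dview-sound (end3 (revD i (len , g))) = revD is3 (cong suc len , fits3D i ∷ᵍ g)
dview-sound (end4 (revD i (len , g))) = revD is4 (cong suc len , fits4D i ∷ᵍ g)

dview : ∀ {n l} → RevD (2 + n) l → DView n l
dview (revD is3 (len , fits32 ∷ᵍ g)) = end23 (suc-injective (suc-injective len) , good-tail g)
dview (revD is3 (len , fits3D i ∷ᵍ g)) = end3 (revD i (suc-injective len , g))
dview (revD is4 (len , fits41 ∷ᵍ g)) = end14 (suc-injective (suc-injective len) , good-tail g)
dview (revD is4 (len , fits4D i ∷ᵍ g)) = end4 (revD i (suc-injective len , g))

data Is26 : ℕ → Set where
  is2 : Is26 2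
  is6 : Is26 6

data RevC (n : ℕ) : Word → Set where
  revC : ∀ {a t} → Is26 a → Walk (1 + double n) a t → RevC n (a ∷ t)

toward4 : ℕ → ℕ
toward4 2 = 3
toward4 _ = 5

data FView (m : ℕ) : Word → Set where
  via34 : ∀ {u} → RevB (2 + m) u → FView m (3 ∷ u)
  via54 : ∀ {u} → RevB (2 + m) u → FView m (5 ∷ u)
  viaC  : ∀ {a r} → RevC (3 + m) (a ∷ r) → FView m (toward4 a ∷ a ∷ r)

fview : ∀ {m t} → Walk (3 + double (3 + m)) 4 t → FView m t
fview (s43 ▸ s34 ▸ w) = via34 (revB w)
fview (s45 ▸ s54 ▸ w) = via54 (revB w)
fview (s43 ▸ s32 ▸ w) = viaC (revC is2 w)
fview (s45 ▸ s56 ▸ w) = viaC (revC is6 w)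

fview-sound : ∀ {m t} → FView m t → RevB (3 + m) (4 ∷ t)
fview-sound (via34 (revB w)) = revB (s43 ▸ s34 ▸ w)
fview-sound (via54 (revB w)) = revB (s45 ▸ s54 ▸ w)
fview-sound (viaC (revC is2 w)) = revB (s43 ▸ s32 ▸ w)
fview-sound (viaC (revC is6 w)) = revB (s45 ▸ s56 ▸ w)

data GView (m : ℕ) : Word → Set where
  via32   : ∀ {u} → RevB (1 + m) u → GView m (2 ∷ 3 ∷ u)
  via56   : ∀ {u} → RevB (1 + m) u → GView m (6 ∷ 5 ∷ u)
  viaDown : ∀ {a r} → RevC (2 + m) (a ∷ r) → GView m (a ∷ pred a ∷ a ∷ r)
  viaUp   : ∀ {a r} → RevC (2 + m) (a ∷ r) → GView m (a ∷ suc a ∷ a ∷ r)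

gview : ∀ {m s} → RevC (3 + m) s → GView m s
gview (revC is2 (s23 ▸ s34 ▸ w)) = via32 (revB w)
gview (revC is6 (s65 ▸ s54 ▸ w)) = via56 (revB w)
gview (revC is2 (s21 ▸ s12 ▸ w)) = viaDown (revC is2 w)
gview (revC is6 (s65 ▸ s56 ▸ w)) = viaDown (revC is6 w)
gview (revC is2 (s23 ▸ s32 ▸ w)) = viaUp (revC is2 w)
gview (revC is6 (s67 ▸ s76 ▸ w)) = viaUp (revC is6 w)

gview-sound : ∀ {m s} → GView m s → RevC (3 + m) s
gview-sound (via32 (revB w)) = revC is2 (s23 ▸ s34 ▸ w)
gview-sound (via56 (revB w)) = revC is6 (s65 ▸ s54 ▸ w)
gview-sound (viaDown (revC is2 w)) = revC is2 (s21 ▸ s12 ▸ w)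
gview-sound (viaDown (revC is6 w)) = revC is6 (s65 ▸ s56 ▸ w)
gview-sound (viaUp (revC is2 w)) = revC is2 (s23 ▸ s32 ▸ w)
gview-sound (viaUp (revC is6 w)) = revC is6 (s67 ▸ s76 ▸ w)

module Recursion (h : Word → Word) where
  open FG h

  -- The unfolding equations below hold by computation: each clause exposes just enough
  -- of the walk to rule out the base clauses of fT / gT, after which both sides reduce
  -- to the same word.

  f-34 : ∀ {k r} → Walk (7 + k) 4 r → fT 4 (3 ∷ 4 ∷ r) ≡ 1 ∷ fT 4 r
  f-34 (s43 ▸ s32 ▸ s21 ▸ _ ▸ _ ▸ _ ▸ _) = refl
  f-34 (s43 ▸ s32 ▸ s23 ▸ _ ▸ _ ▸ _ ▸ _) = refl
  f-34 (s43 ▸ s34 ▸ _ ▸ _ ▸ _ ▸ _ ▸ _) = refl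
  f-34 (s45 ▸ _ ▸ _ ▸ _ ▸ _ ▸ _ ▸ _) = refl

  f-54 : ∀ {k r} → Walk (7 + k) 4 r → fT 4 (5 ∷ 4 ∷ r) ≡ 2 ∷ fT 4 r
  f-54 (s43 ▸ s32 ▸ s21 ▸ _ ▸ _ ▸ _ ▸ _) = refl
  f-54 (s43 ▸ s32 ▸ s23 ▸ _ ▸ _ ▸ _ ▸ _) = refl
  f-54 (s43 ▸ s34 ▸ _ ▸ _ ▸ _ ▸ _ ▸ _) = refl
  f-54 (s45 ▸ _ ▸ _ ▸ _ ▸ _ ▸ _ ▸ _) = refl

  f-C : ∀ {k a r} → Is26 a → Walk (7 + k) a r → fT 4 (toward4 a ∷ a ∷ r) ≡ gT a r
  f-C is2 (s21 ▸ s12 ▸ s21 ▸ s12 ▸ s21 ▸ _ ▸ _) = refl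
  f-C is2 (s21 ▸ s12 ▸ s21 ▸ s12 ▸ s23 ▸ _ ▸ _) = refl
  f-C is2 (s21 ▸ s12 ▸ s23 ▸ s32 ▸ s21 ▸ _ ▸ _) = refl
  f-C is2 (s21 ▸ s12 ▸ s23 ▸ s32 ▸ s23 ▸ _ ▸ _) = refl
  f-C is2 (s21 ▸ s12 ▸ s23 ▸ s34 ▸ _ ▸ _ ▸ _) = refl
  f-C is2 (s23 ▸ s32 ▸ s21 ▸ s12 ▸ s21 ▸ _ ▸ _) = refl
  f-C is2 (s23 ▸ s32 ▸ s21 ▸ s12 ▸ s23 ▸ _ ▸ _) = refl
  f-C is2 (s23 ▸ s32 ▸ s23 ▸ s32 ▸ s21 ▸ _ ▸ _) = refl
  f-C is2 (s23 ▸ s32 ▸ s23 ▸ s32 ▸ s23 ▸ _ ▸ _) = refl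
  f-C is2 (s23 ▸ s32 ▸ s23 ▸ s34 ▸ _ ▸ _ ▸ _) = refl
  f-C is2 (s23 ▸ s34 ▸ s43 ▸ s32 ▸ s21 ▸ _ ▸ _) = refl
  f-C is2 (s23 ▸ s34 ▸ s43 ▸ s32 ▸ s23 ▸ _ ▸ _) = refl
  f-C is2 (s23 ▸ s34 ▸ s43 ▸ s34 ▸ _ ▸ _ ▸ _) = refl
  f-C is2 (s23 ▸ s34 ▸ s45 ▸ _ ▸ _ ▸ _ ▸ _) = refl
  f-C is6 (s65 ▸ s54 ▸ s43 ▸ s32 ▸ s21 ▸ _ ▸ _) = refl
  f-C is6 (s65 ▸ s54 ▸ s43 ▸ s32 ▸ s23 ▸ _ ▸ _) = refl
  f-C is6 (s65 ▸ s54 ▸ s43 ▸ s34 ▸ _ ▸ _ ▸ _) = refl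
  f-C is6 (s65 ▸ s54 ▸ s45 ▸ _ ▸ _ ▸ _ ▸ _) = refl
  f-C is6 (s65 ▸ s56 ▸ _ ▸ _ ▸ _ ▸ _ ▸ _) = refl
  f-C is6 (s67 ▸ s76 ▸ _ ▸ _ ▸ _ ▸ _ ▸ _) = refl

  g-32 : ∀ {k r} → Walk (5 + k) 4 r → gT 2 (3 ∷ 4 ∷ r) ≡ 3 ∷ 2 ∷ fT 4 r
  g-32 (s43 ▸ s32 ▸ s21 ▸ _ ▸ _ ▸ _) = refl
  g-32 (s43 ▸ s32 ▸ s23 ▸ _ ▸ _ ▸ _) = refl
  g-32 (s43 ▸ s34 ▸ _ ▸ _ ▸ _ ▸ _) = refl
  g-32 (s45 ▸ _ ▸ _ ▸ _ ▸ _ ▸ _) = refl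

  g-56 : ∀ {k r} → Walk (5 + k) 4 r → gT 6 (5 ∷ 4 ∷ r) ≡ 4 ∷ 1 ∷ fT 4 r
  g-56 (s43 ▸ s32 ▸ s21 ▸ _ ▸ _ ▸ _) = refl
  g-56 (s43 ▸ s32 ▸ s23 ▸ _ ▸ _ ▸ _) = refl
  g-56 (s43 ▸ s34 ▸ _ ▸ _ ▸ _ ▸ _) = refl
  g-56 (s45 ▸ _ ▸ _ ▸ _ ▸ _ ▸ _) = refl

  g-down : ∀ {k a r} → Is26 a → Walk (5 + k) a r → gT a (pred a ∷ a ∷ r) ≡ 3 ∷ gT a r
  g-down is2 (s21 ▸ s12 ▸ s21 ▸ _ ▸ _ ▸ _) = refl
  g-down is2 (s21 ▸ s12 ▸ s23 ▸ _ ▸ _ ▸ _) = refl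
  g-down is2 (s23 ▸ s32 ▸ s21 ▸ _ ▸ _ ▸ _) = refl
  g-down is2 (s23 ▸ s32 ▸ s23 ▸ _ ▸ _ ▸ _) = refl
  g-down is2 (s23 ▸ s34 ▸ _ ▸ _ ▸ _ ▸ _) = refl
  g-down is6 (_ ▸ _ ▸ _ ▸ _ ▸ _ ▸ _) = refl

  g-up : ∀ {k a r} → Is26 a → Walk (5 + k) a r → gT a (suc a ∷ a ∷ r) ≡ 4 ∷ gT a r
  g-up is2 (s21 ▸ s12 ▸ s21 ▸ _ ▸ _ ▸ _) = refl
  g-up is2 (s21 ▸ s12 ▸ s23 ▸ _ ▸ _ ▸ _) = refl
  g-up is2 (s23 ▸ s32 ▸ s21 ▸ _ ▸ _ ▸ _) = refl
  g-up is2 (s23 ▸ s32 ▸ s23 ▸ _ ▸ _ ▸ _) = refl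
  g-up is2 (s23 ▸ s34 ▸ _ ▸ _ ▸ _ ▸ _) = refl
  g-up is6 (_ ▸ _ ▸ _ ▸ _ ▸ _ ▸ _) = refl

  f-piece : ∀ {m t} → FView m t → Word
  f-piece (via34 {u} _) = 1 ∷ fR u
  f-piece (via54 {u} _) = 2 ∷ fR u
  f-piece (viaC {a} {r} _) = gR (a ∷ r)

  f-unfold : ∀ {m t} (v : FView m t) → fT 4 t ≡ f-piece v
  f-unfold (via34 (revB w)) = f-34 w
  f-unfold (via54 (revB w)) = f-54 w
  f-unfold (viaC (revC i w)) = f-C i w

  g-piece : ∀ {m s} → GView m s → Word
  g-piece (via32 {u} _) = 3 ∷ 2 ∷ fR u
  g-piece (via56 {u} _) = 4 ∷ 1 ∷ fR u
  g-piece (viaDown {a} {r} _) = 3 ∷ gR (a ∷ r)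
  g-piece (viaUp {a} {r} _) = 4 ∷ gR (a ∷ r)

  g-unfold : ∀ {m s} (v : GView m s) → gR s ≡ g-piece v
  g-unfold (via32 (revB w)) = g-32 w
  g-unfold (via56 (revB w)) = g-56 w
  g-unfold (viaDown (revC i w)) = g-down i w
  g-unfold (viaUp (revC i w)) = g-up i w

  FBij : ℕ → Set
  FBij n = BijOn fR (RevB n) (RevA n)

  GBij : ℕ → Set
  GBij n = BijOn gR (RevC n) (RevD n)

  f-step : ∀ m → FBij (2 + m) → GBij (3 + m) → FBij (3 + m)
  f-step m (mapsF , injF , surjF) (mapsG , injG , surjG) = maps , inj , surj
    where
      piece-view : ∀ {t} (v : FView m t) → AView (2 + m) (f-piece v)
      piece-view (via34 u) = end1 (mapsF _ u)
      piece-view (via54 u) = end2 (mapsF _ u)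
      piece-view (viaC c) = endD (mapsG _ c)

      maps : MapsTo fR (RevB (3 + m)) (RevA (3 + m))
      maps _ (revB w) = subst (RevA (3 + m)) (sym (f-unfold (fview w))) (aview-sound (piece-view (fview w)))

      -- Distinct pieces have distinct images: their last letters (1, 2, or 3/4) differ.
      piece-injective : ∀ {t t′} (v : FView m t) (v′ : FView m t′) → f-piece v ≡ f-piece v′ → t ≡ t′
      piece-injective (via34 u) (via34 u′) e = cong (3 ∷_) (injF _ _ u u′ (∷-injectiveʳ e))
      piece-injective (via34 _) (via54 _) ()
      piece-injective (via34 _) (viaC c′) e = ⊥-elim (¬D1 (subst (RevD _) (sym e) (mapsG _ c′)))
      piece-injective (via54 _) (via34 _) ()
      piece-injective (via54 u) (via54 u′) e = cong (5 ∷_) (injF _ _ u u′ (∷-injectiveʳ e))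
      piece-injective (via54 _) (viaC c′) e = ⊥-elim (¬D2 (subst (RevD _) (sym e) (mapsG _ c′)))
      piece-injective (viaC c) (via34 _) e = ⊥-elim (¬D1 (subst (RevD _) e (mapsG _ c)))
      piece-injective (viaC c) (via54 _) e = ⊥-elim (¬D2 (subst (RevD _) e (mapsG _ c)))
      piece-injective (viaC c) (viaC c′) e with injG _ _ c c′ e
      ... | refl = refl

      inj : InjOn fR (RevB (3 + m))
      inj _ _ (revB w) (revB w′) e =
        cong (4 ∷_) (piece-injective (fview w) (fview w′)
          (trans (sym (f-unfold (fview w))) (trans e (f-unfold (fview w′)))))

      preimage : ∀ {l} → AView (2 + m) l → ∃ λ t → Σ (FView m t) λ v → f-piece v ≡ l
      preimage (end1 a) with surjF _ a
      ... | _ , u , e = _ , via34 u , cong (1 ∷_) e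
      preimage (end2 a) with surjF _ a
      ... | _ , u , e = _ , via54 u , cong (2 ∷_) e
      preimage (endD d) with surjG _ d
      ... | _ , c@(revC _ _) , e = _ , viaC c , e

      surj : SurjOnto fR (RevB (3 + m)) (RevA (3 + m))
      surj _ a = let (t , v , e) = preimage (aview a) in 4 ∷ t , fview-sound v , trans (f-unfold v) e

  g-step : ∀ m → GBij (2 + m) → FBij (1 + m) → GBij (3 + m)
  g-step m (mapsG , injG , surjG) (mapsF , injF , surjF) = maps , inj , surj
    where
      piece-view : ∀ {s} (v : GView m s) → DView (1 + m) (g-piece v)
      piece-view (via32 u) = end23 (mapsF _ u)
      piece-view (via56 u) = end14 (mapsF _ u)
      piece-view (viaDown c) = end3 (mapsG _ c)
      piece-view (viaUp c) = end4 (mapsG _ c)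

      maps : MapsTo gR (RevC (3 + m)) (RevD (3 + m))
      maps _ c = subst (RevD (3 + m)) (sym (g-unfold (gview c))) (dview-sound (piece-view (gview c)))

      -- Distinct pieces have distinct images: their last two letters differ.
      piece-injective : ∀ {s s′} (v : GView m s) (v′ : GView m s′) → g-piece v ≡ g-piece v′ → s ≡ s′
      piece-injective (via32 u) (via32 u′) e = cong (λ x → 2 ∷ 3 ∷ x) (injF _ _ u u′ (∷-injectiveʳ (∷-injectiveʳ e)))
      piece-injective (via32 _) (via56 _) ()
      piece-injective (via32 _) (viaDown c′) e = ⊥-elim (¬D2 (subst (RevD _) (sym (∷-injectiveʳ e)) (mapsG _ c′)))
      piece-injective (via32 _) (viaUp _) ()
      piece-injective (via56 _) (via32 _) ()
      piece-injective (via56 u) (via56 u′) e = cong (λ x → 6 ∷ 5 ∷ x) (injF _ _ u u′ (∷-injectiveʳ (∷-injectiveʳ e)))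
      piece-injective (via56 _) (viaDown _) ()
      piece-injective (via56 _) (viaUp c′) e = ⊥-elim (¬D1 (subst (RevD _) (sym (∷-injectiveʳ e)) (mapsG _ c′)))
      piece-injective (viaDown c) (via32 _) e = ⊥-elim (¬D2 (subst (RevD _) (∷-injectiveʳ e) (mapsG _ c)))
      piece-injective (viaDown _) (via56 _) ()
      piece-injective (viaDown c) (viaDown c′) e with injG _ _ c c′ (∷-injectiveʳ e)
      ... | refl = refl
      piece-injective (viaDown _) (viaUp _) ()
      piece-injective (viaUp _) (via32 _) ()
      piece-injective (viaUp c) (via56 _) e = ⊥-elim (¬D1 (subst (RevD _) (∷-injectiveʳ e) (mapsG _ c)))
      piece-injective (viaUp _) (viaDown _) ()
      piece-injective (viaUp c) (viaUp c′) e with injG _ _ c c′ (∷-injectiveʳ e)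
      ... | refl = refl

      inj : InjOn gR (RevC (3 + m))
      inj _ _ c c′ e =
        piece-injective (gview c) (gview c′) (trans (sym (g-unfold (gview c))) (trans e (g-unfold (gview c′))))

      preimage : ∀ {l} → DView (1 + m) l → ∃ λ s → Σ (GView m s) λ v → g-piece v ≡ l
      preimage (end23 a) with surjF _ a
      ... | _ , u , e = _ , via32 u , cong (λ x → 3 ∷ 2 ∷ x) e
      preimage (end14 a) with surjF _ a
      ... | _ , u , e = _ , via56 u , cong (λ x → 4 ∷ 1 ∷ x) e
      preimage (end3 d) with surjG _ d
      ... | _ , c@(revC _ _) , e = _ , viaDown c , cong (3 ∷_) e
      preimage (end4 d) with surjG _ d
      ... | _ , c@(revC _ _) , e = _ , viaUp c , cong (4 ∷_) e

      surj : SurjOnto gR (RevC (3 + m)) (RevD (3 + m))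
      surj _ d = let (s , v , e) = preimage (dview d) in s , gview-sound v , trans (g-unfold v) e

  f₁ : FBij 1
  f₁ = maps , injOn-retraction f₁⁻¹ left-inverse , surj
    where
      maps : MapsTo fR (RevB 1) (RevA 1)
      maps _ (revB w) = by-enumeration {P = λ t → RevA 1 (fT 4 t)}
        ((refl , [ l1 ]ᵍ) ∷ (refl , [ l3 ]ᵍ) ∷ (refl , [ l4 ]ᵍ) ∷ (refl , [ l2 ]ᵍ) ∷ []) w

      f₁⁻¹ : Word → Word
      f₁⁻¹ (1 ∷ []) = 4 ∷ 3 ∷ 2 ∷ 1 ∷ 2 ∷ 1 ∷ []
      f₁⁻¹ (2 ∷ []) = 4 ∷ 5 ∷ 4 ∷ 3 ∷ 2 ∷ 1 ∷ []
      f₁⁻¹ (3 ∷ []) = 4 ∷ 3 ∷ 2 ∷ 3 ∷ 2 ∷ 1 ∷ []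
      f₁⁻¹ (4 ∷ []) = 4 ∷ 3 ∷ 4 ∷ 3 ∷ 2 ∷ 1 ∷ []
      f₁⁻¹ _ = []

      left-inverse : ∀ w → RevB 1 w → f₁⁻¹ (fR w) ≡ w
      left-inverse _ (revB w) = by-enumeration {P = λ t → f₁⁻¹ (fT 4 t) ≡ 4 ∷ t}
        (refl ∷ refl ∷ refl ∷ refl ∷ []) w

      surj : SurjOnto fR (RevB 1) (RevA 1)
      surj _ (refl , [ l1 ]ᵍ) = _ , revB (s43 ▸ s32 ▸ s21 ▸ s12 ▸ s21 ▸ done) , refl
      surj _ (refl , [ l2 ]ᵍ) = _ , revB (s45 ▸ s54 ▸ s43 ▸ s32 ▸ s21 ▸ done) , refl
      surj _ (refl , [ l3 ]ᵍ) = _ , revB (s43 ▸ s32 ▸ s23 ▸ s32 ▸ s21 ▸ done) , refl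
      surj _ (refl , [ l4 ]ᵍ) = _ , revB (s43 ▸ s34 ▸ s43 ▸ s32 ▸ s21 ▸ done) , refl

  g₂ : GBij 2
  g₂ = maps , injOn-retraction g₂⁻¹ left-inverse , surj
    where
      maps : MapsTo gR (RevC 2) (RevD 2)
      maps _ (revC is2 w) = by-enumeration {P = λ t → RevD 2 (gT 2 t)}
        (revD is3 (refl , fits32 ∷ᵍ [ l2 ]ᵍ) ∷ revD is3 (refl , fits3D is4 ∷ᵍ [ l4 ]ᵍ) ∷
         revD is3 (refl , fits3D is3 ∷ᵍ [ l3 ]ᵍ) ∷ revD is4 (refl , fits41 ∷ᵍ [ l1 ]ᵍ) ∷
         revD is4 (refl , fits4D is4 ∷ᵍ [ l4 ]ᵍ) ∷ []) w
      maps _ (revC is6 w) = by-enumeration {P = λ t → RevD 2 (gT 6 t)}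
        (revD is4 (refl , fits4D is3 ∷ᵍ [ l3 ]ᵍ) ∷ []) w

      g₂⁻¹ : Word → Word
      g₂⁻¹ (3 ∷ 2 ∷ []) = 2 ∷ 1 ∷ 2 ∷ 1 ∷ 2 ∷ 1 ∷ []
      g₂⁻¹ (3 ∷ 3 ∷ []) = 2 ∷ 3 ∷ 2 ∷ 1 ∷ 2 ∷ 1 ∷ []
      g₂⁻¹ (3 ∷ 4 ∷ []) = 2 ∷ 1 ∷ 2 ∷ 3 ∷ 2 ∷ 1 ∷ []
      g₂⁻¹ (4 ∷ 1 ∷ []) = 2 ∷ 3 ∷ 2 ∷ 3 ∷ 2 ∷ 1 ∷ []
      g₂⁻¹ (4 ∷ 3 ∷ []) = 6 ∷ 5 ∷ 4 ∷ 3 ∷ 2 ∷ 1 ∷ []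
      g₂⁻¹ (4 ∷ 4 ∷ []) = 2 ∷ 3 ∷ 4 ∷ 3 ∷ 2 ∷ 1 ∷ []
      g₂⁻¹ _ = []

      left-inverse : ∀ s → RevC 2 s → g₂⁻¹ (gR s) ≡ s
      left-inverse _ (revC is2 w) = by-enumeration {P = λ t → g₂⁻¹ (gT 2 t) ≡ 2 ∷ t}
        (refl ∷ refl ∷ refl ∷ refl ∷ refl ∷ []) w
      left-inverse _ (revC is6 w) = by-enumeration {P = λ t → g₂⁻¹ (gT 6 t) ≡ 6 ∷ t} (refl ∷ []) w

      surj : SurjOnto gR (RevC 2) (RevD 2)
      surj _ (revD _ (refl , fits32 ∷ᵍ [ _ ]ᵍ)) = _ , revC is2 (s21 ▸ s12 ▸ s21 ▸ s12 ▸ s21 ▸ done) , refl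
      surj _ (revD _ (refl , fits3D is3 ∷ᵍ [ _ ]ᵍ)) = _ , revC is2 (s23 ▸ s32 ▸ s21 ▸ s12 ▸ s21 ▸ done) , refl
      surj _ (revD _ (refl , fits3D is4 ∷ᵍ [ _ ]ᵍ)) = _ , revC is2 (s21 ▸ s12 ▸ s23 ▸ s32 ▸ s21 ▸ done) , refl
      surj _ (revD _ (refl , fits41 ∷ᵍ [ _ ]ᵍ)) = _ , revC is2 (s23 ▸ s32 ▸ s23 ▸ s32 ▸ s21 ▸ done) , refl
      surj _ (revD _ (refl , fits4D is3 ∷ᵍ [ _ ]ᵍ)) = _ , revC is6 (s65 ▸ s54 ▸ s43 ▸ s32 ▸ s21 ▸ done) , refl
      surj _ (revD _ (refl , fits4D is4 ∷ᵍ [ _ ]ᵍ)) = _ , revC is2 (s23 ▸ s34 ▸ s43 ▸ s32 ▸ s21 ▸ done) , refl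

  -- Base case: on B_2, f is the chosen bijection h (only its bijectivity is needed).
  f₂ : AdmissibleB2 h → FBij 2
  f₂ (h-bij , _) =
    bijOn-cong agrees (bijOn-reverse (λ _ → revB⇒B) (λ _ → B⇒revB) (λ _ → revA⇒A) (λ _ → A⇒revA) h-bij)
    where
      agrees : ∀ w → RevB 2 w → reverse (h (reverse w)) ≡ fR w
      agrees _ (revB w) = by-enumeration {P = λ t → reverse (h (reverse (4 ∷ t))) ≡ fT 4 t}
        (refl ∷ refl ∷ refl ∷ refl ∷ refl ∷ refl ∷ refl ∷ refl ∷ refl ∷ refl ∷ refl ∷ refl ∷ refl ∷ refl ∷ []) w

  mutual
    f-bijective : AdmissibleB2 h → ∀ m → FBij (suc m)
    f-bijective adm zero = f₁
    f-bijective adm (suc zero) = f₂ adm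
    f-bijective adm (suc (suc m)) = f-step m (f-bijective adm (suc m)) (g-bijective adm (suc m))

    g-bijective : AdmissibleB2 h → ∀ m → GBij (2 + m)
    g-bijective adm zero = g₂
    g-bijective adm (suc m) = g-step m (g-bijective adm m) (f-bijective adm m)

B-list : ℕ → List Word
B-list n = map (λ (t , _) → reverse (4 ∷ t)) (walks (3 + double n) 4)

B-count : ∀ n → HasCard (B n) (length (deduplicate _≟ʷ_ (B-list n)))
B-count n = hasCard-list (B-list n) λ w → mk⇔ listed⇒B (B⇒listed w)
  where
    listed⇒B : ∀ {w} → w ∈ B-list n → B n w
    listed⇒B w∈ with ∈-map⁻ _ w∈
    ... | (_ , walk) , _ , refl = revB⇒B (revB walk)
    B⇒listed : ∀ w → B n w → w ∈ B-list n
    B⇒listed w b = subst (_∈ B-list n) (reverse-involutive w) (listed (B⇒revB b))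
      where
        listed : ∀ {l} → RevB n l → reverse l ∈ B-list n
        listed (revB walk) = ∈-map⁺ _ (walk∈walks walk)

mainTheorem1 : (h : Word → Word) → AdmissibleB2 h → (n : ℕ) → 1 ≤ n
    → BijOn (FG.f h) (B n) (A n) × Σ ℕ (λ m → HasCard (A n) m × HasCard (B n) m)
mainTheorem1 h adm (suc m) _ = f-bij , _ , hasCard-image f-bij (B-count (suc m)) , B-count (suc m)
  where
    open Recursion h
    f-bij : BijOn (FG.f h) (B (suc m)) (A (suc m))
    f-bij = bijOn-reverse (λ _ → B⇒revB) (λ _ → revB⇒B) (λ _ → A⇒revA) (λ _ → revA⇒A)
              (f-bijective adm m)
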